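{- Let a graph $G$ of order $n$ be factored into a connected graph $H$ and a graph $K$ with no isolated vertex. If $n$ is odd, then $G$ is connected.
   Context: All graphs are finite and simple. A graph $G$ is factored into graphs $H$ and $K$ (all on $n$ vertices) if there exist adjacency matrices $A,B,C$ of $G,H,K$ respectively (symmetric $n\times n$ $(0,1)$-matrices with zero diagonal, for some vertex orderings) with $A=BC$; the three graphs are then regarded as having the common vertex set $\{1,\dots,n\}$. -}

module Defs where

open import Data.Nat using (ℕ; zero; suc; _+_; _*_)
open import Data.Fin using (Fin)
open import Data.Product using (∃; _×_)
open import Data.Sum using (_⊎_)
open import Relation.Binary.PropositionalEquality using (_≡_)
open import Relation.Nullary using (¬_)
import Data.Vec.Functional as VF

Matrix : ℕ → Set
Matrix n = Fin n → Fin n → ℕ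

sumFin : {n : ℕ} → (Fin n → ℕ) → ℕ
sumFin f = VF.foldr _+_ 0 f

-- Ordinary matrix product over ℕ (= over ℤ for (0,1)-matrices).
_⊗_ : {n : ℕ} → Matrix n → Matrix n → Matrix n
(B ⊗ C) i j = sumFin (λ k → B i k * C k j)

record IsAdjacency {n : ℕ} (A : Matrix n) : Set where
  field
    zero-one  : ∀ i j → A i j ≡ 0 ⊎ A i j ≡ 1
    symmetric : ∀ i j → A i j ≡ A j i
    zero-diag : ∀ i → A i i ≡ 0

Adj : {n : ℕ} → Matrix n → Fin n → Fin n → Set
Adj A i j = A i j ≡ 1

data Walk {n : ℕ} (A : Matrix n) : Fin n → Fin n → Set where
  here : ∀ {i} → Walk A i i
  step : ∀ {i k j} → Adj A i k → Walk A k j → Walk A i j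

Connected : {n : ℕ} → Matrix n → Set
Connected A = ∀ i j → Walk A i j

NoIsolatedVertex : {n : ℕ} → Matrix n → Set
NoIsolatedVertex {n} A = ∀ (i : Fin n) → ∃ λ j → Adj A i j

-- Write H, K for the graphs of B, C. Symmetry of A, B, C gives BC = CB, hence CA = AC, and
-- comparing entries of CA and AC at an H-edge xk shows that x and k have the same K-degree: K is
-- regular. Two vertices with a common H-neighbour i are joined in G through any K-neighbour of i,
-- so along an H-walk alternate vertices stay in one G-component, and G has at most two components:
-- those of a vertex r and of an H-neighbour y of r. If they differ, neither contains a K-edge (it
-- would create an H-edge inside, making it everything), so the components properly 2-colour the
-- regular graph K, and double counting K-edges shows both colour classes have the same size.

module Submission where

open import Defs
open import Data.Nat using (ℕ; zero; suc; _+_; _*_; _≤_; NonZero; >-nonZero)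
open import Data.Nat.Properties
open import Data.Nat.Divisibility using (_∣_; _∣0; m∣m*n)
open import Data.Bool using (Bool; true; false; not)
-- This `sum` unfolds to `sumFin` of Defs, so its lemmas apply to `_⊗_` directly.
open import Algebra.Properties.Semiring.Sum +-*-semiring
  using (sum; sum-cong-≗; ∑-comm; ∑-distrib-+; *-distribˡ-sum; *-distribʳ-sum)
open import Data.Fin using (Fin; zero; suc)
open import Data.Fin.Properties using (any?)
open import Data.Fin.Subset using (Subset; _∈_; _∉_; _⊆_; _⊂_; _⊃_; _∪_; ⁅_⁆)
open import Data.Fin.Subset.Properties using (_∈?_; x∈⁅x⁆; x∈⁅y⁆⇒x≡y; p⊆p∪q; q⊆p∪q; x∈p∪q⁻)
open import Data.Fin.Subset.Induction using (⊃-wellFounded)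
open import Induction.WellFounded using (Acc; acc)
open import Data.Product using (Σ-syntax; ∃; ∃₂; _×_; _,_)
open import Data.Sum using (_⊎_; inj₁; inj₂; [_,_])
open import Function using (_∘_; id; case_of_)
open import Relation.Binary.PropositionalEquality
  using (_≡_; _≢_; refl; sym; trans; cong; cong₂; subst; subst₂; module ≡-Reasoning)
open import Relation.Nullary using (Dec; yes; no; does; ¬_; ¬?; contradiction)
open import Relation.Nullary.Decidable using (_×-dec_; map′; decidable-stable)

private
  variable
    n : ℕ

term≤sum : (f : Fin n → ℕ) (k : Fin n) → f k ≤ sum f
term≤sum f zero    = m≤m+n _ _
term≤sum f (suc k) = ≤-trans (term≤sum (f ∘ suc) k) (m≤n+m _ (f zero))

sum-ones : sum {n} (λ _ → 1) ≡ n
sum-ones {zero}  = refl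
sum-ones {suc n} = cong suc (sum-ones {n})

sum-masked : {f g : Fin n → ℕ} → (∀ j → f j ≡ 0 ⊎ f j ≡ 1) → (∀ j → f j ≡ 1 → g j ≡ 1) →
             sum (λ j → f j * g j) ≡ sum f
sum-masked f01 mask = sum-cong-≗ λ j → masked (f01 j) (mask j)
  where
  masked : ∀ {a b} → a ≡ 0 ⊎ a ≡ 1 → (a ≡ 1 → b ≡ 1) → a * b ≡ a
  masked (inj₁ refl) _ = refl
  masked (inj₂ refl) a⇒b rewrite a⇒b refl = refl

infix 4 _≐_

_≐_ : Matrix n → Matrix n → Set
X ≐ Y = ∀ i j → X i j ≡ Y i j

IsSymmetric : Matrix n → Set
IsSymmetric X = ∀ i j → X i j ≡ X j i

degree : Matrix n → Fin n → ℕ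
degree X i = sum (X i)

degree-nonZero : {X : Matrix n} → NoIsolatedVertex X → ∀ i → NonZero (degree X i)
degree-nonZero {X = X} X-noIso i =
  let j , ij = X-noIso i in >-nonZero (subst (_≤ degree X i) ij (term≤sum (X i) j))

⊗-congˡ : (X : Matrix n) {Y Y′ : Matrix n} → Y ≐ Y′ → X ⊗ Y ≐ X ⊗ Y′
⊗-congˡ X Y≐Y′ i j = sum-cong-≗ λ k → cong (X i k *_) (Y≐Y′ k j)

⊗-congʳ : {X X′ : Matrix n} (Y : Matrix n) → X ≐ X′ → X ⊗ Y ≐ X′ ⊗ Y
⊗-congʳ Y X≐X′ i j = sum-cong-≗ λ k → cong (_* Y k j) (X≐X′ i k)

⊗-assoc : (X Y Z : Matrix n) → (X ⊗ Y) ⊗ Z ≐ X ⊗ (Y ⊗ Z)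
⊗-assoc X Y Z i j = begin
  sum (λ k → sum (λ l → X i l * Y l k) * Z k j)
    ≡⟨ sum-cong-≗ (λ k → *-distribʳ-sum (Z k j) (λ l → X i l * Y l k)) ⟩
  sum (λ k → sum (λ l → X i l * Y l k * Z k j))
    ≡⟨ ∑-comm (λ k l → X i l * Y l k * Z k j) ⟩
  sum (λ l → sum (λ k → X i l * Y l k * Z k j))
    ≡⟨ sum-cong-≗ (λ l → sum-cong-≗ λ k → *-assoc (X i l) (Y l k) (Z k j)) ⟩
  sum (λ l → sum (λ k → X i l * (Y l k * Z k j)))
    ≡⟨ sum-cong-≗ (λ l → *-distribˡ-sum (X i l) (λ k → Y l k * Z k j)) ⟨
  sum (λ l → X i l * sum (λ k → Y l k * Z k j))
    ∎
  where open ≡-Reasoning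

⊗-transpose : {X Y : Matrix n} → IsSymmetric X → IsSymmetric Y →
              ∀ i j → (X ⊗ Y) i j ≡ (Y ⊗ X) j i
⊗-transpose {X = X} {Y} X-sym Y-sym i j = sum-cong-≗ λ k →
  trans (cong₂ _*_ (X-sym i k) (Y-sym k j)) (*-comm (X k i) (Y j k))

Adj-sym : {X : Matrix n} → IsSymmetric X → ∀ {i j} → Adj X i j → Adj X j i
Adj-sym X-sym {i} {j} e = trans (X-sym j i) e

module _ {X : Matrix n} where

  walk-edge : ∀ {i j} → Adj X i j → Walk X i j
  walk-edge e = step e here

  walk-trans : ∀ {i j k} → Walk X i j → Walk X j k → Walk X i k
  walk-trans here       w = w
  walk-trans (step e v) w = step e (walk-trans v w)

  walk-sym : IsSymmetric X → ∀ {i j} → Walk X i j → Walk X j i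
  walk-sym X-sym here       = here
  walk-sym X-sym (step e w) = walk-trans (walk-sym X-sym w) (walk-edge (Adj-sym X-sym e))

  walk-transport : {P : Fin n → Set} → (∀ {i j} → Adj X i j → P i → P j) →
                   ∀ {i j} → Walk X i j → P i → P j
  walk-transport P-step here       p = p
  walk-transport P-step (step e w) p = walk-transport P-step w (P-step e p)

  connected-from : IsSymmetric X → (r : Fin n) → (∀ j → Walk X r j) → Connected X
  connected-from X-sym r reach i j = walk-trans (walk-sym X-sym (reach i)) (reach j)

  first-edge : ∀ {i j} → Walk X i j → i ≢ j → ∃ (Adj X i)
  first-edge here       i≢i = contradiction refl i≢i
  first-edge (step e _) _   = _ , e

module _ (X : Matrix n) where

  ClosedUnder : Subset n → Set
  ClosedUnder p = ∀ {v w} → Adj X v w → v ∈ p → w ∈ p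

  ReachableFrom : Fin n → Subset n → Set
  ReachableFrom i p = ∀ {j} → j ∈ p → Walk X i j

  closed-or-exit : (p : Subset n) → ClosedUnder p ⊎ ∃₂ λ v w → v ∈ p × Adj X v w × w ∉ p
  closed-or-exit p with any? (λ v → any? λ w → (v ∈? p) ×-dec (X v w ≟ 1) ×-dec ¬? (w ∈? p))
  ... | yes exit = inj₂ exit
  ... | no ¬exit = inj₁ λ {v} {w} vw v∈p →
    decidable-stable (w ∈? p) λ w∉p → ¬exit (v , w , v∈p , vw , w∉p)

  saturate : ∀ {i} (p : Subset n) → Acc _⊃_ p → ReachableFrom i p →
             Σ[ q ∈ Subset n ] p ⊆ q × ClosedUnder q × ReachableFrom i q
  saturate {i} p (acc larger) p-reach with closed-or-exit p
  ... | inj₁ closed = p , id , closed , p-reach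
  ... | inj₂ (v , w , v∈p , vw , w∉p) =
    let q , p∪w⊆q , q-closed , q-reach = saturate (p ∪ ⁅ w ⁆) (larger p⊂p∪w) p∪w-reach
    in  q , p∪w⊆q ∘ p⊆p∪q ⁅ w ⁆ , q-closed , q-reach
    where
    p⊂p∪w : p ⊂ p ∪ ⁅ w ⁆
    p⊂p∪w = p⊆p∪q ⁅ w ⁆ , w , q⊆p∪q p ⁅ w ⁆ (x∈⁅x⁆ w) , w∉p

    p∪w-reach : ReachableFrom i (p ∪ ⁅ w ⁆)
    p∪w-reach j∈p∪w with x∈p∪q⁻ p ⁅ w ⁆ j∈p∪w
    ... | inj₁ j∈p = p-reach j∈p
    ... | inj₂ j∈w rewrite x∈⁅y⁆⇒x≡y w j∈w = walk-trans (p-reach v∈p) (walk-edge vw)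

  walk? : ∀ i j → Dec (Walk X i j)
  walk? i j =
    let q , i∈q , q-closed , q-reach = saturate ⁅ i ⁆ (⊃-wellFounded _) ⁅i⁆-reach
    in  map′ q-reach (λ ij → walk-transport q-closed ij (i∈q (x∈⁅x⁆ i))) (j ∈? q)
    where
    ⁅i⁆-reach : ReachableFrom i ⁅ i ⁆
    ⁅i⁆-reach j∈i rewrite x∈⁅y⁆⇒x≡y i j∈i = here

does≡not-does : {P Q : Set} (P? : Dec P) (Q? : Dec Q) → (P → ¬ Q) → (¬ P → ¬ ¬ Q) →
                does P? ≡ not (does Q?)
does≡not-does (yes p) (yes q) p⇒¬q _     = contradiction q (p⇒¬q p)
does≡not-does (yes _) (no _)  _     _     = refl
does≡not-does (no _)  (yes _) _     _     = refl
does≡not-does (no ¬p) (no ¬q) _     ¬p⇒q = contradiction ¬q (¬p⇒q ¬p)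

indicator : Bool → ℕ
indicator true  = 1
indicator false = 0

module _ {C : Matrix n} (C-adj : IsAdjacency C) {d : ℕ} (regular : ∀ i → degree C i ≡ d) where
  open IsAdjacency C-adj

  ∑-weighted-degrees : (f : Fin n → ℕ) → sum (λ i → sum (λ j → f i * C i j)) ≡ d * sum f
  ∑-weighted-degrees f = begin
    sum (λ i → sum (λ j → f i * C i j)) ≡⟨ sum-cong-≗ (λ i → *-distribˡ-sum (f i) (C i)) ⟨
    sum (λ i → f i * degree C i)        ≡⟨ sum-cong-≗ (λ i → cong (f i *_) (regular i)) ⟩
    sum (λ i → f i * d)                 ≡⟨ sum-cong-≗ (λ i → *-comm (f i) d) ⟩
    sum (λ i → d * f i)                 ≡⟨ *-distribˡ-sum d f ⟨
    d * sum f                           ∎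
    where open ≡-Reasoning

  properly-2-coloured⇒even : .{{NonZero d}} → (side : Fin n → Bool) →
                             (∀ {i j} → Adj C i j → side i ≡ not (side j)) → 2 ∣ n
  properly-2-coloured⇒even side proper = subst (2 ∣_) two-halves (m∣m*n (sum χ))
    where
    χ ψ : Fin n → ℕ
    χ i = indicator (side i)
    ψ i = indicator (not (side i))

    crossing : ∀ i j → χ i * C i j ≡ ψ j * C i j
    crossing i j with zero-one i j
    ... | inj₁ Cij≡0 rewrite Cij≡0 = trans (*-zeroʳ (χ i)) (sym (*-zeroʳ (ψ j)))
    ... | inj₂ Cij≡1 rewrite Cij≡1 = cong (λ b → indicator b * 1) (proper Cij≡1)

    balanced : sum χ ≡ sum ψ
    balanced = *-cancelˡ-≡ (sum χ) (sum ψ) d (begin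
      d * sum χ
        ≡⟨ ∑-weighted-degrees χ ⟨
      sum (λ i → sum (λ j → χ i * C i j))
        ≡⟨ sum-cong-≗ (λ i → sum-cong-≗ (crossing i)) ⟩
      sum (λ i → sum (λ j → ψ j * C i j))
        ≡⟨ ∑-comm (λ i j → ψ j * C i j) ⟩
      sum (λ j → sum (λ i → ψ j * C i j))
        ≡⟨ sum-cong-≗ (λ j → sum-cong-≗ λ i → cong (ψ j *_) (symmetric i j)) ⟩
      sum (λ j → sum (λ i → ψ j * C j i))
        ≡⟨ ∑-weighted-degrees ψ ⟩
      d * sum ψ
        ∎)
      where open ≡-Reasoning

    partition : sum χ + sum ψ ≡ n
    partition = begin
      sum χ + sum ψ          ≡⟨ ∑-distrib-+ χ ψ ⟨
      sum (λ i → χ i + ψ i)  ≡⟨ sum-cong-≗ (λ i → one-side (side i)) ⟩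
      sum {n} (λ _ → 1)      ≡⟨ sum-ones ⟩
      n                      ∎
      where
      open ≡-Reasoning
      one-side : ∀ b → indicator b + indicator (not b) ≡ 1
      one-side true  = refl
      one-side false = refl

    two-halves : 2 * sum χ ≡ n
    two-halves = begin
      sum χ + (sum χ + 0) ≡⟨ cong (sum χ +_) (trans (+-identityʳ (sum χ)) balanced) ⟩
      sum χ + sum ψ       ≡⟨ partition ⟩
      n                   ∎
      where open ≡-Reasoning

adjacent-through : {A X Y : Matrix n} → (∀ i j → A i j ≡ 0 ⊎ A i j ≡ 1) → A ≐ X ⊗ Y →
                   ∀ {i k j} → Adj X i k → Adj Y k j → Adj A i j
adjacent-through {X = X} {Y} A01 A≐XY {i} {k} {j} ik kj with A01 i j
... | inj₂ Aij≡1 = Aij≡1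
... | inj₁ Aij≡0 = contradiction
  (subst₂ _≤_ (cong₂ _*_ ik kj) (trans (sym (A≐XY i j)) Aij≡0) (term≤sum (λ l → X i l * Y l j) k))
  λ ()

module Factorisation {A B C : Matrix n}
  (A-adj : IsAdjacency A) (B-adj : IsAdjacency B) (C-adj : IsAdjacency C) (A≐BC : A ≐ B ⊗ C) where

  private
    module A = IsAdjacency A-adj
    module B = IsAdjacency B-adj
    module C = IsAdjacency C-adj

  A≐CB : A ≐ C ⊗ B
  A≐CB i j = trans (A.symmetric i j) (trans (A≐BC j i) (⊗-transpose B.symmetric C.symmetric j i))

  B-then-C : ∀ {i k j} → Adj B i k → Adj C k j → Adj A i j
  B-then-C = adjacent-through {X = B} {C} A.zero-one A≐BC

  C-then-B : ∀ {i k j} → Adj C i k → Adj B k j → Adj A i j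
  C-then-B = adjacent-through {X = C} {B} A.zero-one A≐CB

  C⊗A≐A⊗C : C ⊗ A ≐ A ⊗ C
  C⊗A≐A⊗C i j = begin
    (C ⊗ A) i j       ≡⟨ ⊗-congˡ C A≐BC i j ⟩
    (C ⊗ (B ⊗ C)) i j ≡⟨ ⊗-assoc C B C i j ⟨
    ((C ⊗ B) ⊗ C) i j ≡⟨ ⊗-congʳ C A≐CB i j ⟨
    (A ⊗ C) i j       ∎
    where open ≡-Reasoning

  degree-along-B : ∀ {x k} → Adj B x k → degree C k ≡ degree C x
  degree-along-B {x} {k} xk = begin
    degree C k  ≡⟨ sum-masked (C.zero-one k) (λ j kj → C-then-B (Adj-sym C.symmetric kj) kx) ⟨
    (C ⊗ A) k x ≡⟨ C⊗A≐A⊗C k x ⟩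
    (A ⊗ C) k x ≡⟨ ⊗-transpose A.symmetric C.symmetric k x ⟩
    (C ⊗ A) x k ≡⟨ sum-masked (C.zero-one x) (λ j xj → C-then-B (Adj-sym C.symmetric xj) xk) ⟩
    degree C x  ∎
    where
    open ≡-Reasoning
    kx = Adj-sym B.symmetric xk

  module _ (C-noIso : NoIsolatedVertex C) where

    common-B-neighbour : ∀ {i u v} → Adj B i u → Adj B i v → Walk A u v
    common-B-neighbour {i} iu iv =
      let z , iz = C-noIso i
      in  step (B-then-C (Adj-sym B.symmetric iu) iz)
               (walk-edge (Adj-sym A.symmetric (B-then-C (Adj-sym B.symmetric iv) iz)))

    walk-from-vertex-or-neighbour : ∀ {x x′ w} → Walk B x w → Adj B x x′ →
                                    Walk A x w ⊎ Walk A x′ w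
    walk-from-vertex-or-neighbour here _ = inj₁ here
    walk-from-vertex-or-neighbour (step xk kw) xx′
      with walk-from-vertex-or-neighbour kw (Adj-sym B.symmetric xk)
    ... | inj₁ k⇝w = inj₂ (walk-trans (common-B-neighbour xx′ xk) k⇝w)
    ... | inj₂ x⇝w = inj₁ x⇝w

    module _ (B-conn : Connected B) where

      B-noIso : NoIsolatedVertex B
      B-noIso v = let j , vj = C-noIso v in first-edge (B-conn v j) λ v≡j →
        contradiction (trans (sym (C.zero-diag v)) (subst (Adj C v) (sym v≡j) vj)) λ ()

      C-regular : ∀ r i → degree C i ≡ degree C r
      C-regular r i = walk-transport (λ xk dx → trans (degree-along-B xk) dx) (B-conn r i) refl

      component-with-B-edge-is-total : ∀ {r u h} → Adj B u h → Walk A r u → Walk A r h →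
                                       ∀ w → Walk A r w
      component-with-B-edge-is-total {u = u} uh r⇝u r⇝h w =
        [ walk-trans r⇝u , walk-trans r⇝h ] (walk-from-vertex-or-neighbour (B-conn u w) uh)

      component-with-C-edge-is-total : ∀ {r u v} → Adj C u v → Walk A r u → Walk A r v →
                                       ∀ w → Walk A r w
      component-with-C-edge-is-total {u = u} uv r⇝u r⇝v =
        let h , uh = B-noIso u
            vh = Adj-sym A.symmetric (B-then-C (Adj-sym B.symmetric uh) uv)
        in  component-with-B-edge-is-total uh r⇝u (walk-trans r⇝v (walk-edge vh))

      connected-if-reaches-neighbour : ∀ {r y} → Adj B r y → Walk A r y → Connected A
      connected-if-reaches-neighbour {r} ry r⇝y = connected-from A.symmetric r λ w →
        [ id , walk-trans r⇝y ] (walk-from-vertex-or-neighbour (B-conn r w) ry)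

      even-if-misses-neighbour : ∀ {r y} → Adj B r y → ¬ Walk A r y → 2 ∣ n
      even-if-misses-neighbour {r} {y} ry r⇸y =
        properly-2-coloured⇒even C-adj (C-regular r) {{degree-nonZero C-noIso r}} side proper
        where
        side : Fin n → Bool
        side i = does (walk? A r i)

        y-reaches : ∀ {i} → ¬ Walk A r i → Walk A y i
        y-reaches {i} r⇸i =
          [ (λ r⇝i → contradiction r⇝i r⇸i) , id ] (walk-from-vertex-or-neighbour (B-conn r i) ry)

        proper : ∀ {i j} → Adj C i j → side i ≡ not (side j)
        proper {i} {j} ij = does≡not-does (walk? A r i) (walk? A r j)
          (λ r⇝i r⇝j → r⇸y (component-with-C-edge-is-total ij r⇝i r⇝j y))
          (λ r⇸i r⇸j → r⇸y (walk-sym A.symmetric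
            (component-with-C-edge-is-total ij (y-reaches r⇸i) (y-reaches r⇸j) r)))

corollary6p7 : (n : ℕ) (A B C : Matrix n) →
    IsAdjacency A → IsAdjacency B → IsAdjacency C →
    (∀ i j → A i j ≡ (B ⊗ C) i j) →
    Connected B → NoIsolatedVertex C → ¬ (2 ∣ n) →
    Connected A
corollary6p7 zero    A B C _ _ _ _ _ _ odd = contradiction (2 ∣0) odd
corollary6p7 (suc n) A B C A-adj B-adj C-adj A≐BC B-conn C-noIso odd =
  let y , 0y = B-noIso C-noIso B-conn zero in
  case walk? A zero y of λ where
    (yes 0⇝y) → connected-if-reaches-neighbour C-noIso B-conn 0y 0⇝y
    (no 0⇸y)  → contradiction (even-if-misses-neighbour C-noIso B-conn 0y 0⇸y) odd
  where open Factorisation A-adj B-adj C-adj A≐BC
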